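{- Let $\tau=(w,x)$ be a pair. Then for every $p\in X^c_\tau$ the set $\mathcal{A}'_\tau(p)=\mathcal{A}_\tau(p)\cap R'_\tau$ is nonempty.
   Context: $S_n$ is the symmetric group on $\{1,\dots,n\}$ with Bruhat order $\le$ and length $\ell$; $y\lessdot z$ means $y<z$, $\ell(z)=\ell(y)+1$. $\Box=\{0,\dots,n\}^2$; for $a=(a_1,a_2),b=(b_1,b_2)\in\Box$, $a\le b$ means $a_1\le b_1$ and $a_2\le b_2$. For $w\in S_n$, $\mathrm{rk}_w(i,j)=\#\{u\le i:w(u)\le j\}$ on $\Box$. A pair is $\tau=(w,x)$ with $x\le w$; $\mathrm{rk}_\tau=\mathrm{rk}_x-\mathrm{rk}_w$, $X_\tau=\{p\in\Box:\mathrm{rk}_\tau(p)=0\}$, $X^c_\tau=\Box\setminus X_\tau$. $t_{i_1,i_2}$ ($i_1<i_2$) is the transposition of $i_1,i_2$; $R_\tau=\{t:x<xt\le w\}$, $R'_\tau=\{t:x\lessdot xt\le w\}$. For $p\in\Box$, $\mathcal{A}_\tau(p)=\{t_{i_1,i_2}\in R_\tau:(i_1,x(i_1))\le p\text{ but }(i_2,x(i_2))\not\le p\}$. -}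

module Defs where

open import Data.Nat using (ℕ; _<_; _≤_; _+_)
open import Data.Fin using (Fin; toℕ)
open import Data.Fin.Permutation using (Permutation′; _⟨$⟩ʳ_; _∘ₚ_; transpose)
open import Data.List using (List; length; filter; allFin; concatMap; map)
open import Data.Product using (_×_; _,_; Σ; ∃; ∃-syntax)
open import Relation.Binary.PropositionalEquality using (_≡_)
open import Relation.Nullary using (¬_)
open import Relation.Nullary.Decidable using (_×-dec_)
import Data.Nat.Properties as ℕP

-- S_n : permutations of Fin n (Fin n = {0,…,n-1} stands for {1,…,n}, i ↦ toℕ i + 1).
Perm : ℕ → Set
Perm n = Permutation′ n

module _ {n : ℕ} where

  _≈ₚ_ : Perm n → Perm n → Set
  x ≈ₚ y = ∀ u → x ⟨$⟩ʳ u ≡ y ⟨$⟩ʳ u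

  -- x t_{i,j} : (x t)(u) = x (t u), i.e. right multiplication by the transposition
  _·t[_,_] : Perm n → Fin n → Fin n → Perm n
  x ·t[ i , j ] = transpose i j ∘ₚ x

  -- length = number of inversions: pairs u < v with w(u) > w(v)
  len : Perm n → ℕ
  len w = length (filter (λ p → (toℕ (Data.Product.proj₁ p) ℕP.<? toℕ (Data.Product.proj₂ p))
                                 ×-dec (toℕ (w ⟨$⟩ʳ Data.Product.proj₂ p) ℕP.<? toℕ (w ⟨$⟩ʳ Data.Product.proj₁ p)))
                         (concatMap (λ u → map (λ v → (u , v)) (allFin n)) (allFin n)))

  -- Bruhat order: reflexive–transitive closure of  y → y t  with  ℓ(y) < ℓ(y t)
  data _≤B_ : Perm n → Perm n → Set where
    ≤B-refl : ∀ {x y} → x ≈ₚ y → x ≤B y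
    ≤B-step : ∀ {x y z} (i j : Fin n) → x ≤B y → toℕ i < toℕ j →
              len y < len (y ·t[ i , j ]) → z ≈ₚ (y ·t[ i , j ]) → x ≤B z

  _<B_ : Perm n → Perm n → Set
  x <B y = x ≤B y × ¬ (x ≈ₚ y)

  _⋖_ : Perm n → Perm n → Set
  y ⋖ z = y <B z × len z ≡ len y + 1

  -- rk_w(i,j) = #{u ≤ i : w(u) ≤ j} for (i,j) ∈ {0,…,n}², in 1-based labels;
  -- with 0-based Fin labels:  #{u : toℕ u < i, toℕ (w u) < j}.
  rk : Perm n → ℕ → ℕ → ℕ
  rk w i j = length (filter (λ u → (toℕ u ℕP.<? i) ×-dec (toℕ (w ⟨$⟩ʳ u) ℕP.<? j)) (allFin n))

  InBox : ℕ × ℕ → Set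
  InBox (p₁ , p₂) = p₁ ≤ n × p₂ ≤ n

  -- (u, x(u)) ≤ p componentwise (1-based labels: u+1 ≤ p₁ and x(u)+1 ≤ p₂)
  _≤pt_ : (Fin n × Fin n) → ℕ × ℕ → Set
  (u , v) ≤pt (p₁ , p₂) = toℕ u < p₁ × toℕ v < p₂

  -- A pair τ = (w, x) with x ≤ w.
  -- p ∈ X^c_τ  iff  rk_τ(p) = rk_x(p) - rk_w(p) ≠ 0
  InXc : (w x : Perm n) → ℕ × ℕ → Set
  InXc w x (p₁ , p₂) = InBox (p₁ , p₂) × ¬ (rk x p₁ p₂ ≡ rk w p₁ p₂)

  InR' : (w x : Perm n) → Fin n → Fin n → Set
  InR' w x i₁ i₂ = toℕ i₁ < toℕ i₂ × (x ⋖ (x ·t[ i₁ , i₂ ])) × ((x ·t[ i₁ , i₂ ]) ≤B w)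

  InR : (w x : Perm n) → Fin n → Fin n → Set
  InR w x i₁ i₂ = toℕ i₁ < toℕ i₂ × (x <B (x ·t[ i₁ , i₂ ])) × ((x ·t[ i₁ , i₂ ]) ≤B w)

  InA : (w x : Perm n) → ℕ × ℕ → Fin n → Fin n → Set
  InA w x p i₁ i₂ = InR w x i₁ i₂ × ((i₁ , x ⟨$⟩ʳ i₁) ≤pt p) × ¬ ((i₂ , x ⟨$⟩ʳ i₂) ≤pt p)

module Submission where

-- Call (a, b) a good pair for x if a < b, x(a) < x(b) (an ascent),
-- (a, x(a)) ≤ p, (b, x(b)) ≰ p and x t_{ab} ≤ w.  The proof has four parts.
--  1. Length (module LengthChange): exchanging an ascent (i, j) strictly
--     increases the number of inversions, by exactly one when no point of the
--     graph of x lies strictly inside the rectangle spanned by (i, x(i)) and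
--     (j, x(j)).
--
-- Conventions: positions and values are 0-based (Fin n); the point (u, x(u))
-- lies below p = (p₁, p₂) when u < p₁ and x(u) < p₂; T i j is the
-- transposition t_{ij} of Fin n, so (x t_{ij})(u) = x(T i j u).

open import Defs
open import Data.Nat using (ℕ; zero; suc; _+_; _≤_; _<_; _<?_; z≤n; s≤s⁻¹)
open import Data.Nat.Properties
open import Data.Fin using (Fin; toℕ; zero; suc) renaming (_≟_ to _≟F_)
open import Data.Fin.Properties using (toℕ-injective; punchInᵢ≢i; any?)
open import Data.Fin.Permutation using (_⟨$⟩ʳ_; _⟨$⟩ˡ_; transpose; inverseˡ)
import Data.Fin.Permutation.Components as PC
open import Data.List using (List; _++_; length; filter; tabulate; concat; concatMap; map; allFin)
open import Data.List.Properties using (filter-++; length-++; map-tabulate)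
open import Data.Product using (_×_; _,_; proj₁; proj₂; ∃-syntax)
open import Data.Empty using (⊥; ⊥-elim)
open import Data.Bool using (if_then_else_)
open import Function using (_∘_)
open import Relation.Binary.PropositionalEquality
open import Relation.Nullary using (¬_; Dec; yes; no; does; contradiction)
open import Relation.Nullary.Decidable using (_×-dec_; ¬?; dec-true; dec-false)
open import Relation.Unary using (Pred; Decidable)
open import Data.Nat.Solver using (module +-*-Solver)
open import Algebra.Properties.CommutativeMonoid.Sum +-0-commutativeMonoid
  using (sum; sum-syntax; sum-cong-≗; ∑-distrib-+; sum-permute; sum-remove; sum-replicate-zero)
open import Data.Vec.Functional using (removeAt)

open +-*-Solver using (solve; _:+_; _:=_; con)

<⇒≢F : ∀ {n} {i j : Fin n} → toℕ i < toℕ j → i ≢ j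
<⇒≢F i<j refl = <-irrefl refl i<j

module _ {n : ℕ} where

  T : Fin n → Fin n → Fin n → Fin n
  T = PC.transpose

  T-left : ∀ i j → T i j i ≡ j
  T-left i j rewrite dec-true (i ≟F i) refl = refl

  T-right : ∀ i j → T i j j ≡ i
  T-right i j with j ≟F i
  ... | yes j≡i = j≡i
  ... | no j≢i rewrite dec-true (j ≟F j) refl = refl

  T-other : ∀ i j {k} → k ≢ i → k ≢ j → T i j k ≡ k
  T-other i j {k} k≢i k≢j rewrite dec-false (k ≟F i) k≢i | dec-false (k ≟F j) k≢j = refl

  data Position (i j : Fin n) : Fin n → Set where
    at-i      : Position i j i
    at-j      : Position i j j
    elsewhere : ∀ {k} → k ≢ i → k ≢ j → Position i j k

  position : ∀ i j k → Position i j k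
  position i j k with k ≟F i | k ≟F j
  ... | yes refl | _ = at-i
  ... | no _ | yes refl = at-j
  ... | no k≢i | no k≢j = elsewhere k≢i k≢j

  T-invol : ∀ i j k → T i j (T i j k) ≡ k
  T-invol i j k with position i j k
  ... | at-i = trans (cong (T i j) (T-left i j)) (T-right i j)
  ... | at-j = trans (cong (T i j) (T-right i j)) (T-left i j)
  ... | elsewhere k≢i k≢j = trans (cong (T i j) (T-other i j k≢i k≢j)) (T-other i j k≢i k≢j)

  T-natural : (f : Fin n → Fin n) → (∀ {u v} → f u ≡ f v → u ≡ v) →
              ∀ i j k → f (T i j k) ≡ T (f i) (f j) (f k)
  T-natural f f-inj i j k with position i j k
  ... | at-i = trans (cong f (T-left i j)) (sym (T-left (f i) (f j)))
  ... | at-j = trans (cong f (T-right i j)) (sym (T-right (f i) (f j)))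
  ... | elsewhere k≢i k≢j = trans (cong f (T-other i j k≢i k≢j))
                                  (sym (T-other (f i) (f j) (k≢i ∘ f-inj) (k≢j ∘ f-inj)))

  T-slide : ∀ a b {c d c′ d′} → T a b c ≡ c′ → T a b d ≡ d′ →
            ∀ u → T a b (T c d u) ≡ T c′ d′ (T a b u)
  T-slide a b {c} {d} refl refl = T-natural (T a b) T-inj c d
    where
      T-inj : ∀ {u v} → T a b u ≡ T a b v → u ≡ v
      T-inj {u} {v} e = trans (sym (T-invol a b u)) (trans (cong (T a b) e) (T-invol a b v))

  T-conjugate : ∀ {a b c} → a ≢ c → a ≢ b → ∀ u → T c b (T a c (T c b u)) ≡ T a b u
  T-conjugate {a} {b} {c} a≢c a≢b u =
    trans (T-slide c b (T-other c b a≢c a≢b) (T-left c b) (T c b u)) (cong (T a b) (T-invol c b u))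

  T-keeps-order : ∀ {i j u v} → toℕ i < toℕ j → toℕ u < toℕ v → u ≢ i → v ≢ j →
                  toℕ (T i j u) < toℕ (T i j v)
  T-keeps-order {i} {j} {u} {v} i<j u<v u≢i v≢j with position i j u | position i j v
  ... | at-i | _ = contradiction refl u≢i
  ... | _ | at-j = contradiction refl v≢j
  ... | at-j | at-i = ⊥-elim (<-asym i<j u<v)
  ... | at-j | elsewhere v≢i _ =
    subst₂ (λ a b → toℕ a < toℕ b) (sym (T-right i j)) (sym (T-other i j v≢i v≢j)) (<-trans i<j u<v)
  ... | elsewhere _ u≢j | at-i =
    subst₂ (λ a b → toℕ a < toℕ b) (sym (T-other i j u≢i u≢j)) (sym (T-left i j)) (<-trans u<v i<j)
  ... | elsewhere _ u≢j | elsewhere v≢i _ =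
    subst₂ (λ a b → toℕ a < toℕ b) (sym (T-other i j u≢i u≢j)) (sym (T-other i j v≢i v≢j)) u<v

sum-mono : ∀ {n} (f g : Fin n → ℕ) → (∀ u → f u ≤ g u) → sum f ≤ sum g
sum-mono {zero} f g f≤g = z≤n
sum-mono {suc n} f g f≤g = +-mono-≤ (f≤g zero) (sum-mono (f ∘ suc) (g ∘ suc) (f≤g ∘ suc))

sum-except-≤ : ∀ {n} (c : Fin n) (f g : Fin n → ℕ) → (∀ u → u ≢ c → f u ≤ g u) →
               sum f + g c ≤ sum g + f c
sum-except-≤ {suc n} c f g f≤g = begin
  sum f + g c                           ≡⟨ cong (_+ g c) (sum-remove {i = c} f) ⟩
  (f c + sum (removeAt f c)) + g c      ≡⟨ swap-ends (f c) _ (g c) ⟩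
  (g c + sum (removeAt f c)) + f c      ≤⟨ +-monoˡ-≤ (f c) (+-monoʳ-≤ (g c) rest≤) ⟩
  (g c + sum (removeAt g c)) + f c      ≡⟨ cong (_+ f c) (sum-remove {i = c} g) ⟨
  sum g + f c                           ∎
  where
    open ≤-Reasoning
    rest≤ : sum (removeAt f c) ≤ sum (removeAt g c)
    rest≤ = sum-mono _ _ (λ k → f≤g _ (punchInᵢ≢i c k))
    swap-ends : ∀ a r b → (a + r) + b ≡ (b + r) + a
    swap-ends = solve 3 (λ a r b → (a :+ r) :+ b := (b :+ r) :+ a) refl

sum-except : ∀ {n} (c : Fin n) (f g : Fin n → ℕ) → (∀ u → u ≢ c → f u ≡ g u) →
             sum f + g c ≡ sum g + f c
sum-except c f g f≡g = ≤-antisym (sum-except-≤ c f g (λ u u≢c → ≤-reflexive (f≡g u u≢c)))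
                                 (sum-except-≤ c g f (λ u u≢c → ≤-reflexive (sym (f≡g u u≢c))))

sum-point : ∀ {n} (c : Fin n) (f : Fin n → ℕ) → (∀ u → u ≢ c → f u ≡ 0) → sum f ≡ f c
sum-point {n} c f f≡0 = begin
  sum f                 ≡⟨ +-identityʳ (sum f) ⟨
  sum f + 0             ≡⟨ sum-except c f (λ _ → 0) f≡0 ⟩
  ∑[ u < n ] 0 + f c    ≡⟨ cong (_+ f c) (sum-replicate-zero n) ⟩
  f c                   ∎
  where open ≡-Reasoning

sum-except₂ : ∀ {n} {c d : Fin n} (f g : Fin n → ℕ) → c ≢ d →
              (∀ u → u ≢ c → u ≢ d → f u ≡ g u) → f c + f d ≡ g c + g d → sum f ≡ sum g
sum-except₂ {c = c} {d} f g c≢d f≡g fcd≡gcd = +-cancelʳ-≡ (g c + g d) (sum f) (sum g) (begin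
  sum f + (g c + g d)    ≡⟨ +-assoc (sum f) _ _ ⟨
  (sum f + g c) + g d    ≡⟨ cong (λ z → (sum f + z) + g d) h-at-c ⟨
  (sum f + h c) + g d    ≡⟨ cong (_+ g d) (sum-except c f h (λ u u≢c → sym (h-off-c u u≢c))) ⟩
  (sum h + f c) + g d    ≡⟨ +-assoc (sum h) _ _ ⟩
  sum h + (f c + g d)    ≡⟨ cong (sum h +_) (+-comm (f c) (g d)) ⟩
  sum h + (g d + f c)    ≡⟨ +-assoc (sum h) _ _ ⟨
  (sum h + g d) + f c    ≡⟨ cong (_+ f c) (sum-except d h g h-off-d) ⟩
  (sum g + h d) + f c    ≡⟨ cong (λ z → (sum g + z) + f c) (h-off-c d (c≢d ∘ sym)) ⟩
  (sum g + f d) + f c    ≡⟨ +-assoc (sum g) _ _ ⟩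
  sum g + (f d + f c)    ≡⟨ cong (sum g +_) (trans (+-comm (f d) (f c)) fcd≡gcd) ⟩
  sum g + (g c + g d)    ∎)
  where
    open ≡-Reasoning
    h : Fin _ → ℕ
    h u = if does (u ≟F c) then g c else f u
    h-at-c : h c ≡ g c
    h-at-c rewrite dec-true (c ≟F c) refl = refl
    h-off-c : ∀ u → u ≢ c → h u ≡ f u
    h-off-c u u≢c rewrite dec-false (u ≟F c) u≢c = refl
    h-off-d : ∀ u → u ≢ d → h u ≡ g u
    h-off-d u u≢d with u ≟F c
    ... | yes refl = refl
    ... | no u≢c = f≡g u u≢c u≢d

∑∑ : ∀ {n} → (Fin n → Fin n → ℕ) → ℕ
∑∑ {n} F = ∑[ u < n ] ∑[ v < n ] F u v

∑∑-cong : ∀ {n} {F G : Fin n → Fin n → ℕ} → (∀ u v → F u v ≡ G u v) → ∑∑ F ≡ ∑∑ G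
∑∑-cong F≡G = sum-cong-≗ (λ u → sum-cong-≗ (F≡G u))

∑∑-distrib-+ : ∀ {n} (F G : Fin n → Fin n → ℕ) → ∑∑ (λ u v → F u v + G u v) ≡ ∑∑ F + ∑∑ G
∑∑-distrib-+ F G = trans (sum-cong-≗ (λ u → ∑-distrib-+ (F u) (G u))) (∑-distrib-+ (λ u → sum (F u)) (λ u → sum (G u)))

sum-cross : ∀ {n} (F : Fin n → Fin n → ℕ) (a b : Fin n) → (∀ u v → u ≢ a → v ≢ b → F u v ≡ 0) →
            ∑∑ F + F a b ≡ ∑[ v < n ] F a v + ∑[ u < n ] F u b
sum-cross {n} F a b F≡0 =
  trans (sum-except a (λ u → sum (F u)) (λ u → F u b) (λ u u≢a → sum-point b (F u) (λ v → F≡0 u v u≢a)))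
        (+-comm (∑[ u < n ] F u b) (sum (F a)))

𝟙 : ∀ {p} {P : Set p} → Dec P → ℕ
𝟙 d = if does d then 1 else 0

𝟙-yes : ∀ {p} {P : Set p} (d : Dec P) → P → 𝟙 d ≡ 1
𝟙-yes (yes _) _ = refl
𝟙-yes (no ¬p) p = contradiction p ¬p

𝟙-no : ∀ {p} {P : Set p} (d : Dec P) → ¬ P → 𝟙 d ≡ 0
𝟙-no (yes p) ¬p = contradiction p ¬p
𝟙-no (no _) _ = refl

𝟙-mono : ∀ {p q} {P : Set p} {Q : Set q} (d : Dec P) (e : Dec Q) → (P → Q) → 𝟙 d ≤ 𝟙 e
𝟙-mono (yes p) e P→Q = ≤-reflexive (sym (𝟙-yes e (P→Q p)))
𝟙-mono (no _) e _ = z≤n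

module _ {a p} {A : Set a} {P : Pred A p} (P? : Decidable P) where

  count-tabulate : ∀ {n} (f : Fin n → A) → length (filter P? (tabulate f)) ≡ ∑[ u < n ] 𝟙 (P? (f u))
  count-tabulate {zero} f = refl
  count-tabulate {suc n} f with P? (f zero)
  ... | yes _ = cong suc (count-tabulate (f ∘ suc))
  ... | no _ = count-tabulate (f ∘ suc)

  count-concat : ∀ {n} (g : Fin n → List A) →
                 length (filter P? (concat (tabulate g))) ≡ ∑[ u < n ] length (filter P? (g u))
  count-concat {zero} g = refl
  count-concat {suc n} g = begin
    length (filter P? (g zero ++ concat (tabulate (g ∘ suc))))
      ≡⟨ cong length (filter-++ P? (g zero) _) ⟩
    length (filter P? (g zero) ++ filter P? (concat (tabulate (g ∘ suc))))
      ≡⟨ length-++ (filter P? (g zero)) ⟩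
    length (filter P? (g zero)) + length (filter P? (concat (tabulate (g ∘ suc))))
      ≡⟨ cong (length (filter P? (g zero)) +_) (count-concat (g ∘ suc)) ⟩
    length (filter P? (g zero)) + ∑[ u < n ] length (filter P? (g (suc u))) ∎
    where open ≡-Reasoning

count-pairs : ∀ {n p} {P : Pred (Fin n × Fin n) p} (P? : Decidable P) →
  length (filter P? (concatMap (λ u → map (λ v → (u , v)) (allFin n)) (allFin n))) ≡
  ∑∑ (λ u v → 𝟙 (P? (u , v)))
count-pairs {n} P? = begin
  length (filter P? (concat (map row (allFin n))))  ≡⟨ cong (length ∘ filter P? ∘ concat) (map-tabulate (λ u → u) row) ⟩
  length (filter P? (concat (tabulate row)))         ≡⟨ count-concat P? row ⟩
  ∑[ u < n ] length (filter P? (row u))              ≡⟨ sum-cong-≗ count-row ⟩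
  ∑∑ (λ u v → 𝟙 (P? (u , v)))                        ∎
  where
    open ≡-Reasoning
    row : Fin n → List (Fin n × Fin n)
    row u = map (λ v → (u , v)) (allFin n)
    count-row : ∀ u → length (filter P? (row u)) ≡ ∑[ v < n ] 𝟙 (P? (u , v))
    count-row u = trans (cong (length ∘ filter P?) (map-tabulate (λ v → v) (u ,_))) (count-tabulate P? (u ,_))

-- [b ∧ c] + [a ∧ ¬b ∧ c] = [a ∧ c] + [¬a ∧ b ∧ c]: exchanging the condition a for b
-- inside an indicator costs exactly the pairs on which a and b disagree.
𝟙-exchange : ∀ {p q r} {A : Set p} {B : Set q} {C : Set r} (a : Dec A) (b : Dec B) (c : Dec C) →
  𝟙 (b ×-dec c) + 𝟙 (a ×-dec ¬? b ×-dec c) ≡ 𝟙 (a ×-dec c) + 𝟙 (¬? a ×-dec b ×-dec c)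
𝟙-exchange (yes _) (yes _) c = refl
𝟙-exchange (yes _) (no _) c = +-comm 0 (𝟙 c)
𝟙-exchange (no _) (yes _) c = +-comm (𝟙 c) 0
𝟙-exchange (no _) (no _) c = refl

module _ {n : ℕ} where

  val : Perm n → Fin n → ℕ
  val x u = toℕ (x ⟨$⟩ʳ u)

  val-injective : ∀ (x : Perm n) {u v} → val x u ≡ val x v → u ≡ v
  val-injective x {u} {v} e =
    trans (sym (inverseˡ x)) (trans (cong (x ⟨$⟩ˡ_) (toℕ-injective e)) (inverseˡ x))

  inv : Perm n → Fin n → Fin n → ℕ
  inv x u v = 𝟙 ((toℕ u <? toℕ v) ×-dec (val x v <? val x u))

  len-sum : ∀ x → len x ≡ ∑∑ (inv x)
  len-sum x = count-pairs (λ p → (toℕ (proj₁ p) <? toℕ (proj₂ p)) ×-dec (val x (proj₂ p) <? val x (proj₁ p)))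

  len-cong : ∀ {x y} → x ≈ₚ y → len x ≡ len y
  len-cong {x} {y} x≈y = begin
    len x          ≡⟨ len-sum x ⟩
    ∑∑ (inv x)     ≡⟨ ∑∑-cong (λ u v → cong₂ (λ a b → 𝟙 ((toℕ u <? toℕ v) ×-dec (toℕ b <? toℕ a))) (x≈y u) (x≈y v)) ⟩
    ∑∑ (inv y)     ≡⟨ len-sum y ⟨
    len y          ∎
    where open ≡-Reasoning

  below : Perm n → ℕ → ℕ → Fin n → ℕ
  below x p₁ p₂ u = 𝟙 ((toℕ u <? p₁) ×-dec (val x u <? p₂))

  rk-sum : ∀ x p₁ p₂ → rk x p₁ p₂ ≡ sum (below x p₁ p₂)
  rk-sum x p₁ p₂ = count-tabulate (λ u → (toℕ u <? p₁) ×-dec (val x u <? p₂)) (λ u → u)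

  rk-cong : ∀ {x y} p₁ p₂ → x ≈ₚ y → rk x p₁ p₂ ≡ rk y p₁ p₂
  rk-cong {x} {y} p₁ p₂ x≈y = begin
    rk x p₁ p₂            ≡⟨ rk-sum x p₁ p₂ ⟩
    sum (below x p₁ p₂)   ≡⟨ sum-cong-≗ (λ u → cong (λ a → 𝟙 ((toℕ u <? p₁) ×-dec (toℕ a <? p₂))) (x≈y u)) ⟩
    sum (below y p₁ p₂)   ≡⟨ rk-sum y p₁ p₂ ⟨
    rk y p₁ p₂            ∎
    where open ≡-Reasoning

≮∧≢⇒> : ∀ {a b} → ¬ a < b → b ≢ a → b < a
≮∧≢⇒> ¬a<b b≢a = ≤∧≢⇒< (≮⇒≥ ¬a<b) b≢a

EmptyRectangle : ∀ {n} → Perm n → Fin n → Fin n → Set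
EmptyRectangle y i j = ∀ c → toℕ i < toℕ c → toℕ c < toℕ j → val y i < val y c → val y c < val y j → ⊥

-- Relabelling positions by τ = t_{ij}, the inversions of
-- y t_{ij} are the value-descending pairs of y that are ordered after τ; so
-- ℓ(y t_{ij}) + #lost = ℓ(y) + #gained, where lost/gained pairs change their order
-- under τ.  Lost pairs live in row i and column j, gained pairs in row j and
-- column i, and comparing these rows and columns gives ℓ(y) < ℓ(y t_{ij}), with
-- ℓ(y t_{ij}) = ℓ(y) + 1 when the rectangle spanned by i and j is empty.
module LengthChange {n : ℕ} (y : Perm n) {i j : Fin n}
                    (i<j : toℕ i < toℕ j) (yi<yj : val y i < val y j) where

  τ : Fin n → Fin n
  τ = T i j

  before : (u v : Fin n) → Dec (toℕ u < toℕ v)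
  before u v = toℕ u <? toℕ v

  falls : (u v : Fin n) → Dec (val y v < val y u)
  falls u v = val y v <? val y u

  after : Fin n → Fin n → ℕ
  after u v = 𝟙 (before (τ u) (τ v) ×-dec falls u v)

  lost? : (u v : Fin n) → Dec (toℕ u < toℕ v × ¬ toℕ (τ u) < toℕ (τ v) × val y v < val y u)
  lost? u v = before u v ×-dec ¬? (before (τ u) (τ v)) ×-dec falls u v

  gained? : (u v : Fin n) → Dec (¬ toℕ u < toℕ v × toℕ (τ u) < toℕ (τ v) × val y v < val y u)
  gained? u v = ¬? (before u v) ×-dec before (τ u) (τ v) ×-dec falls u v

  lost gained : Fin n → Fin n → ℕ
  lost u v = 𝟙 (lost? u v)
  gained u v = 𝟙 (gained? u v)

  len-after : len (y ·t[ i , j ]) ≡ ∑∑ after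
  len-after = begin
    len (y ·t[ i , j ])                         ≡⟨ len-sum (y ·t[ i , j ]) ⟩
    ∑∑ (inv y′)                                 ≡⟨ sum-cong-≗ (λ u → sum-permute (inv y′ u) (transpose i j)) ⟩
    ∑[ u < n ] ∑[ v < n ] inv y′ u (τ v)        ≡⟨ sum-permute (λ u → ∑[ v < n ] inv y′ u (τ v)) (transpose i j) ⟩
    ∑∑ (λ u v → inv y′ (τ u) (τ v))             ≡⟨ ∑∑-cong relabel ⟩
    ∑∑ after                                    ∎
    where
      open ≡-Reasoning
      y′ = y ·t[ i , j ]
      relabel : ∀ u v → inv y′ (τ u) (τ v) ≡ after u v
      relabel u v rewrite T-invol i j u | T-invol i j v = refl

  balance : len (y ·t[ i , j ]) + ∑∑ lost ≡ len y + ∑∑ gained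
  balance = begin
    len (y ·t[ i , j ]) + ∑∑ lost                ≡⟨ cong (_+ ∑∑ lost) len-after ⟩
    ∑∑ after + ∑∑ lost                           ≡⟨ ∑∑-distrib-+ after lost ⟨
    ∑∑ (λ u v → after u v + lost u v)            ≡⟨ ∑∑-cong (λ u v → 𝟙-exchange (before u v) (before (τ u) (τ v)) (falls u v)) ⟩
    ∑∑ (λ u v → inv y u v + gained u v)          ≡⟨ ∑∑-distrib-+ (inv y) gained ⟩
    ∑∑ (inv y) + ∑∑ gained                       ≡⟨ cong (_+ ∑∑ gained) (len-sum y) ⟨
    len y + ∑∑ gained                            ∎
    where open ≡-Reasoning

  τ-order : ∀ a b {a′ b′} → τ a ≡ a′ → τ b ≡ b′ → toℕ a′ < toℕ b′ → toℕ (τ a) < toℕ (τ b)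
  τ-order a b refl refl lt = lt

  τ-order⁻ : ∀ a b {a′ b′} → τ a ≡ a′ → τ b ≡ b′ → toℕ (τ a) < toℕ (τ b) → toℕ a′ < toℕ b′
  τ-order⁻ a b refl refl lt = lt

  τ≡i⇒j : ∀ {u} → τ u ≡ i → u ≡ j
  τ≡i⇒j {u} τu≡i = trans (sym (T-invol i j u)) (trans (cong τ τu≡i) (T-left i j))

  τ≡j⇒i : ∀ {u} → τ u ≡ j → u ≡ i
  τ≡j⇒i {u} τu≡j = trans (sym (T-invol i j u)) (trans (cong τ τu≡j) (T-right i j))

  lost-support : ∀ u v → u ≢ i → v ≢ j → lost u v ≡ 0
  lost-support u v u≢i v≢j = 𝟙-no (lost? u v)
    λ { (u<v , ¬τu<τv , _) → ¬τu<τv (T-keeps-order i<j u<v u≢i v≢j) }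

  gained-support : ∀ u v → u ≢ j → v ≢ i → gained u v ≡ 0
  gained-support u v u≢j v≢i = 𝟙-no (gained? u v)
    λ { (¬u<v , τu<τv , _) → ¬u<v (subst₂ (λ a b → toℕ a < toℕ b) (T-invol i j u) (T-invol i j v)
                                      (T-keeps-order i<j τu<τv (u≢j ∘ τ≡i⇒j) (v≢i ∘ τ≡j⇒i))) }

  lost-ii : lost i i ≡ 0
  lost-ii = 𝟙-no (lost? i i) λ { (i<i , _) → <-irrefl refl i<i }

  lost-jj : lost j j ≡ 0
  lost-jj = 𝟙-no (lost? j j) λ { (j<j , _) → <-irrefl refl j<j }

  lost-ij : lost i j ≡ 0
  lost-ij = 𝟙-no (lost? i j) λ { (_ , _ , yj<yi) → <-asym yi<yj yj<yi }

  gained-ii : gained i i ≡ 0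
  gained-ii = 𝟙-no (gained? i i) λ { (_ , τi<τi , _) → <-irrefl refl τi<τi }

  gained-jj : gained j j ≡ 0
  gained-jj = 𝟙-no (gained? j j) λ { (_ , τj<τj , _) → <-irrefl refl τj<τj }

  gained-ji : gained j i ≡ 1
  gained-ji = 𝟙-yes (gained? j i) (<-asym i<j , τ-order j i (T-right i j) (T-left i j) i<j , yi<yj)

  row-≤ : ∀ v → v ≢ i → lost i v ≤ gained j v
  row-≤ v v≢i with position i j v
  ... | at-i = contradiction refl v≢i
  ... | at-j = ≤-trans (≤-reflexive lost-ij) z≤n
  ... | elsewhere _ v≢j = 𝟙-mono (lost? i v) (gained? j v)
    λ { (i<v , ¬τi<τv , yv<yi) →
          (λ j<v → ¬τi<τv (τ-order i v (T-left i j) τv≡v j<v)) ,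
          τ-order j v (T-right i j) τv≡v i<v ,
          <-trans yv<yi yi<yj }
    where τv≡v = T-other i j v≢i v≢j

  col-≤ : ∀ u → u ≢ j → lost u j ≤ gained u i
  col-≤ u u≢j with position i j u
  ... | at-i = ≤-trans (≤-reflexive lost-ij) z≤n
  ... | at-j = contradiction refl u≢j
  ... | elsewhere u≢i _ = 𝟙-mono (lost? u j) (gained? u i)
    λ { (u<j , ¬τu<τj , yj<yu) →
          (λ u<i → ¬τu<τj (τ-order u j τu≡u (T-right i j) u<i)) ,
          τ-order u i τu≡u (T-left i j) u<j ,
          <-trans yi<yj yj<yu }
    where τu≡u = T-other i j u≢i u≢j

  rowˡ colˡ rowᵍ colᵍ : ℕ
  rowˡ = ∑[ v < n ] lost i v
  colˡ = ∑[ u < n ] lost u j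
  rowᵍ = ∑[ v < n ] gained j v
  colᵍ = ∑[ u < n ] gained u i

  lost-total : ∑∑ lost ≡ rowˡ + colˡ
  lost-total = begin
    ∑∑ lost              ≡⟨ +-identityʳ (∑∑ lost) ⟨
    ∑∑ lost + 0          ≡⟨ cong (∑∑ lost +_) lost-ij ⟨
    ∑∑ lost + lost i j   ≡⟨ sum-cross lost i j lost-support ⟩
    rowˡ + colˡ          ∎
    where open ≡-Reasoning

  gained-total : ∑∑ gained + 1 ≡ rowᵍ + colᵍ
  gained-total = trans (cong (∑∑ gained +_) (sym gained-ji)) (sum-cross gained j i gained-support)

  -- Comparing at the extra gained pair (j, i).
  row-strict : rowˡ + 1 ≤ rowᵍ
  row-strict = subst₂ _≤_ (cong (rowˡ +_) gained-ji) (trans (cong (rowᵍ +_) lost-ii) (+-identityʳ rowᵍ))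
                      (sum-except-≤ i (lost i) (gained j) row-≤)

  col-strict : colˡ + 1 ≤ colᵍ
  col-strict = subst₂ _≤_ (cong (colˡ +_) gained-ji) (trans (cong (colᵍ +_) lost-jj) (+-identityʳ colᵍ))
                      (sum-except-≤ j (λ u → lost u j) (λ u → gained u i) col-≤)

  length-increases : len y < len (y ·t[ i , j ])
  length-increases = +-cancelʳ-< (∑∑ lost) (len y) (len (y ·t[ i , j ])) (begin-strict
    len y + ∑∑ lost                 <⟨ +-monoʳ-< (len y) lost<gained ⟩
    len y + ∑∑ gained               ≡⟨ balance ⟨
    len (y ·t[ i , j ]) + ∑∑ lost   ∎)
    where
      open ≤-Reasoning
      lost<gained : ∑∑ lost < ∑∑ gained
      lost<gained = +-cancelʳ-≤ 1 (suc (∑∑ lost)) (∑∑ gained) (begin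
        suc (∑∑ lost) + 1          ≡⟨ cong (λ s → suc s + 1) lost-total ⟩
        suc (rowˡ + colˡ) + 1      ≡⟨ solve 2 (λ r c → (con 1 :+ (r :+ c)) :+ con 1 := (r :+ con 1) :+ (c :+ con 1)) refl rowˡ colˡ ⟩
        (rowˡ + 1) + (colˡ + 1)    ≤⟨ +-mono-≤ row-strict col-strict ⟩
        rowᵍ + colᵍ                ≡⟨ gained-total ⟨
        ∑∑ gained + 1              ∎)

  -- With an empty rectangle the row and column comparisons are exact away
  -- from the pair (j, i), so exactly one inversion is created.
  module _ (empty : EmptyRectangle y i j) where

    row-≥ : ∀ v → v ≢ i → gained j v ≤ lost i v
    row-≥ v v≢i with position i j v
    ... | at-i = contradiction refl v≢i
    ... | at-j = ≤-trans (≤-reflexive gained-jj) z≤n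
    ... | elsewhere _ v≢j = 𝟙-mono (gained? j v) (lost? i v)
      λ { (¬j<v , τj<τv , yv<yj) →
            let i<v = τ-order⁻ j v (T-right i j) τv≡v τj<τv in
            i<v ,
            (λ τi<τv → ¬j<v (τ-order⁻ i v (T-left i j) τv≡v τi<τv)) ,
            yv<yi i<v (≮∧≢⇒> ¬j<v (v≢j ∘ toℕ-injective)) yv<yj }
      where
        τv≡v = T-other i j v≢i v≢j
        yv<yi : toℕ i < toℕ v → toℕ v < toℕ j → val y v < val y j → val y v < val y i
        yv<yi i<v v<j yv<yj with val y v <? val y i
        ... | yes yv<yi = yv<yi
        ... | no ¬yv<yi = ⊥-elim (empty v i<v v<j (≮∧≢⇒> ¬yv<yi (v≢i ∘ val-injective y ∘ sym)) yv<yj)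

    col-≥ : ∀ u → u ≢ j → gained u i ≤ lost u j
    col-≥ u u≢j with position i j u
    ... | at-i = ≤-trans (≤-reflexive gained-ii) z≤n
    ... | at-j = contradiction refl u≢j
    ... | elsewhere u≢i _ = 𝟙-mono (gained? u i) (lost? u j)
      λ { (¬u<i , τu<τi , yi<yu) →
            let u<j = τ-order⁻ u i τu≡u (T-left i j) τu<τi in
            u<j ,
            (λ τu<τj → ¬u<i (τ-order⁻ u j τu≡u (T-right i j) τu<τj)) ,
            yj<yu (≮∧≢⇒> ¬u<i (u≢i ∘ toℕ-injective ∘ sym)) u<j yi<yu }
      where
        τu≡u = T-other i j u≢i u≢j
        yj<yu : toℕ i < toℕ u → toℕ u < toℕ j → val y i < val y u → val y j < val y u
        yj<yu i<u u<j yi<yu with val y j <? val y u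
        ... | yes yj<yu = yj<yu
        ... | no ¬yj<yu = ⊥-elim (empty u i<u u<j yi<yu (≮∧≢⇒> ¬yj<yu (u≢j ∘ val-injective y)))

    row-exact : rowᵍ ≡ rowˡ + 1
    row-exact = trans (sym (trans (cong (rowᵍ +_) lost-ii) (+-identityʳ rowᵍ)))
      (trans (sum-except i (gained j) (lost i) (λ v v≢i → ≤-antisym (row-≥ v v≢i) (row-≤ v v≢i)))
             (cong (rowˡ +_) gained-ji))

    col-exact : colᵍ ≡ colˡ + 1
    col-exact = trans (sym (trans (cong (colᵍ +_) lost-jj) (+-identityʳ colᵍ)))
      (trans (sum-except j (λ u → gained u i) (λ u → lost u j) (λ u u≢j → ≤-antisym (col-≥ u u≢j) (col-≤ u u≢j)))
             (cong (colˡ +_) gained-ji))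

    length-covers : len (y ·t[ i , j ]) ≡ len y + 1
    length-covers = +-cancelʳ-≡ (∑∑ lost) (len (y ·t[ i , j ])) (len y + 1) (begin
      len (y ·t[ i , j ]) + ∑∑ lost     ≡⟨ balance ⟩
      len y + ∑∑ gained                 ≡⟨ cong (len y +_) gained≡lost+1 ⟩
      len y + (∑∑ lost + 1)             ≡⟨ solve 2 (λ l s → l :+ (s :+ con 1) := (l :+ con 1) :+ s) refl (len y) (∑∑ lost) ⟩
      (len y + 1) + ∑∑ lost             ∎)
      where
        open ≡-Reasoning
        gained≡lost+1 : ∑∑ gained ≡ ∑∑ lost + 1
        gained≡lost+1 = +-cancelʳ-≡ 1 (∑∑ gained) (∑∑ lost + 1) (begin
          ∑∑ gained + 1                 ≡⟨ gained-total ⟩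
          rowᵍ + colᵍ                   ≡⟨ cong₂ _+_ row-exact col-exact ⟩
          (rowˡ + 1) + (colˡ + 1)       ≡⟨ solve 2 (λ r c → (r :+ con 1) :+ (c :+ con 1) := ((r :+ c) :+ con 1) :+ con 1) refl rowˡ colˡ ⟩
          ((rowˡ + colˡ) + 1) + 1       ≡⟨ cong (λ s → (s + 1) + 1) lost-total ⟨
          (∑∑ lost + 1) + 1             ∎)

module _ {n : ℕ} where

  increase⇒ascent : ∀ (y : Perm n) {i j} → toℕ i < toℕ j → len y < len (y ·t[ i , j ]) → val y i < val y j
  increase⇒ascent y {i} {j} i<j ℓ< with val y i <? val y j
  ... | yes yi<yj = yi<yj
  ... | no ¬yi<yj = ⊥-elim (<-asym ℓ< (subst (len y′ <_) (len-cong {x = y′ ·t[ i , j ]} {y = y} undo)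
                                               (LengthChange.length-increases y′ i<j y′i<y′j)))
    where
      -- otherwise (i, j) is an ascent of y′ = y t_{ij}, and exchanging it gives back y
      y′ = y ·t[ i , j ]
      y′i<y′j : val y′ i < val y′ j
      y′i<y′j = subst₂ _<_ (cong (val y) (sym (T-left i j))) (cong (val y) (sym (T-right i j)))
                        (≮∧≢⇒> ¬yi<yj (<⇒≢F i<j ∘ sym ∘ val-injective y))
      undo : (y′ ·t[ i , j ]) ≈ₚ y
      undo u = cong (y ⟨$⟩ʳ_) (T-invol i j u)

-- Two points (c, a), (d, b) with c < d, a < b and their exchange (c, b), (d, a)
-- have the same number of points in a lower-left box, unless (c, a) lies in
-- the box and (d, b) does not.  Here the box conditions on the coordinates are
-- abstracted to decidable C, D (first coordinate) and A, B (second), with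
-- D → C and B → A expressing c < d and a < b.
corner-count : ∀ {p} {C D A B : Set p} (c? : Dec C) (d? : Dec D) (a? : Dec A) (b? : Dec B) →
  (D → C) → (B → A) → ¬ ((C × A) × ¬ (D × B)) →
  𝟙 (c? ×-dec b?) + 𝟙 (d? ×-dec a?) ≡ 𝟙 (c? ×-dec a?) + 𝟙 (d? ×-dec b?)
corner-count (no _)  (no _)  _       _       _   _   _     = refl
corner-count (no ¬c) (yes d) _       _       D→C _   _     = contradiction (D→C d) ¬c
corner-count (yes _) (yes _) a?      b?      _   _   _     = +-comm (𝟙 b?) (𝟙 a?)
corner-count (yes _) (no _)  (yes _) (yes _) _   _   _     = refl
corner-count (yes c) (no ¬d) (yes a) (no _)  _   _   ¬cross = contradiction ((c , a) , ¬d ∘ proj₁) ¬cross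
corner-count (yes _) (no _)  (no ¬a) (yes b) _   B→A _     = contradiction (B→A b) ¬a
corner-count (yes _) (no _)  (no _)  (no _)  _   _   _     = refl

module _ {n : ℕ} where

  Crosses : Perm n → ℕ × ℕ → Fin n → Fin n → Set
  Crosses x p c d = (c , x ⟨$⟩ʳ c) ≤pt p × ¬ ((d , x ⟨$⟩ʳ d) ≤pt p)

  rk-swap : ∀ (x : Perm n) {c d} p₁ p₂ → toℕ c < toℕ d → val x c < val x d →
            ¬ Crosses x (p₁ , p₂) c d → rk (x ·t[ c , d ]) p₁ p₂ ≡ rk x p₁ p₂
  rk-swap x {c} {d} p₁ p₂ c<d xc<xd ¬cross = begin
    rk (x ·t[ c , d ]) p₁ p₂            ≡⟨ rk-sum (x ·t[ c , d ]) p₁ p₂ ⟩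
    sum (below (x ·t[ c , d ]) p₁ p₂)   ≡⟨ sum-except₂ _ _ (<⇒≢F c<d) off-cd on-cd ⟩
    sum (below x p₁ p₂)                 ≡⟨ rk-sum x p₁ p₂ ⟨
    rk x p₁ p₂                          ∎
    where
      open ≡-Reasoning
      box : Fin n → ℕ → ℕ
      box u v = 𝟙 ((toℕ u <? p₁) ×-dec (v <? p₂))
      off-cd : ∀ u → u ≢ c → u ≢ d → below (x ·t[ c , d ]) p₁ p₂ u ≡ below x p₁ p₂ u
      off-cd u u≢c u≢d = cong (box u ∘ val x) (T-other c d u≢c u≢d)
      on-cd : below (x ·t[ c , d ]) p₁ p₂ c + below (x ·t[ c , d ]) p₁ p₂ d ≡
              below x p₁ p₂ c + below x p₁ p₂ d
      on-cd = trans (cong₂ _+_ (cong (box c ∘ val x) (T-left c d)) (cong (box d ∘ val x) (T-right c d)))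
                    (corner-count (toℕ c <? p₁) (toℕ d <? p₁) (val x c <? p₂) (val x d <? p₂)
                                  (<-trans c<d) (<-trans xc<xd) ¬cross)

module _ {n : ℕ} where

  ≤B-congʳ : ∀ {x y z : Perm n} → x ≤B y → y ≈ₚ z → x ≤B z
  ≤B-congʳ (≤B-refl x≈y) y≈z = ≤B-refl (λ u → trans (x≈y u) (y≈z u))
  ≤B-congʳ (≤B-step i j x≤y i<j ℓ< z≈) y≈z = ≤B-step i j x≤y i<j ℓ< (λ u → trans (sym (y≈z u)) (z≈ u))

  ≤B-trans : ∀ {x y z : Perm n} → x ≤B y → y ≤B z → x ≤B z
  ≤B-trans x≤y (≤B-refl y≈z) = ≤B-congʳ x≤y y≈z
  ≤B-trans x≤y (≤B-step i j y≤v i<j ℓ< z≈) = ≤B-step i j (≤B-trans x≤y y≤v) i<j ℓ< z≈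

  ascent-≤B : ∀ (x : Perm n) {i j} → toℕ i < toℕ j → val x i < val x j → x ≤B (x ·t[ i , j ])
  ascent-≤B x {i} {j} i<j xi<xj =
    ≤B-step {y = x} i j (≤B-refl (λ _ → refl)) i<j (LengthChange.length-increases x i<j xi<xj) (λ _ → refl)

  ascent-<B : ∀ (x : Perm n) {i j} → toℕ i < toℕ j → val x i < val x j → x <B (x ·t[ i , j ])
  ascent-<B x {i} {j} i<j xi<xj = ascent-≤B x i<j xi<xj , λ x≈xt →
    <⇒≢F i<j (val-injective x (cong toℕ (trans (x≈xt i) (cong (x ⟨$⟩ʳ_) (T-left i j)))))

  climb : ∀ (z : Perm n) {i j} {v w : Perm n} → toℕ i < toℕ j → val z i < val z j →
          (z ·t[ i , j ]) ≈ₚ v → v ≤B w → z ≤B w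
  climb z i<j zi<zj zt≈v v≤w = ≤B-trans (ascent-≤B z i<j zi<zj) (≤B-trans (≤B-refl zt≈v) v≤w)

  -- x ↝ w: w is reached from x by ascent exchanges, the first one applied to x.
  data _↝_ : Perm n → Perm n → Set where
    stop : ∀ {x w} → x ≈ₚ w → x ↝ w
    step : ∀ {x w} c d → toℕ c < toℕ d → val x c < val x d → (x ·t[ c , d ]) ↝ w → x ↝ w

  -- Appending an ascent exchange at the top of a chain; this converts the
  -- upward-built chains of ≤B into chains starting at x.
  ↝-snoc : ∀ {x y z} → x ↝ y → ∀ i j → toℕ i < toℕ j → val y i < val y j → z ≈ₚ (y ·t[ i , j ]) → x ↝ z
  ↝-snoc (stop x≈y) i j i<j yi<yj z≈ =
    step i j i<j (subst₂ _<_ (cong toℕ (sym (x≈y i))) (cong toℕ (sym (x≈y j))) yi<yj)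
         (stop (λ u → trans (x≈y (T i j u)) (sym (z≈ u))))
  ↝-snoc (step c d c<d xc<xd rest) i j i<j yi<yj z≈ = step c d c<d xc<xd (↝-snoc rest i j i<j yi<yj z≈)

  ≤B⇒↝ : ∀ {x w} → x ≤B w → x ↝ w
  ≤B⇒↝ (≤B-refl x≈w) = stop x≈w
  ≤B⇒↝ (≤B-step {y = y} i j x≤y i<j ℓ< z≈) = ↝-snoc (≤B⇒↝ x≤y) i j i<j (increase⇒ascent y i<j ℓ<) z≈

  ↝⇒≤B : ∀ {x w} → x ↝ w → x ≤B w
  ↝⇒≤B (stop x≈w) = ≤B-refl x≈w
  ↝⇒≤B {x} (step c d c<d xc<xd rest) = ≤B-trans (ascent-≤B x c<d xc<xd) (↝⇒≤B rest)

-- A pair (a, b) is good for x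
-- if it is an ascent of x crossing p with x t_{ab} ≤ w; this is the statement
-- of the theorem except that the exchange need not be a covering.

module GoodPairs {n : ℕ} (w : Perm n) (p₁ p₂ : ℕ) where

  Good : Perm n → Fin n → Fin n → Set
  Good x a b = toℕ a < toℕ b × val x a < val x b × Crosses x (p₁ , p₂) a b × (x ·t[ a , b ]) ≤B w

  GoodPair : Perm n → Set
  GoodPair x = ∃[ a ] ∃[ b ] Good x a b

  box? : (x : Perm n) (u : Fin n) → Dec ((u , x ⟨$⟩ʳ u) ≤pt (p₁ , p₂))
  box? x u = (toℕ u <? p₁) ×-dec (val x u <? p₂)

  -- Transfer along one ascent exchange: if (c, d) is an ascent of x with
  -- y = x t_{cd} ≤ w, every good pair of y yields a good pair of x.  Either the
  -- pair of y can be used for x after moving the exchange (c, d) past it, or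
  -- (c, d) itself is good for x.
  module Transfer (x : Perm n) {c d : Fin n} (c<d : toℕ c < toℕ d) (xc<xd : val x c < val x d)
                  (y≤w : (x ·t[ c , d ]) ≤B w) where

    y : Perm n
    y = x ·t[ c , d ]

    X : Fin n → ℕ
    X = val x

    c≢d : c ≢ d
    c≢d = <⇒≢F c<d

    yc : val y c ≡ X d
    yc = cong X (T-left c d)

    yd : val y d ≡ X c
    yd = cong X (T-right c d)

    y-other : ∀ {u} → u ≢ c → u ≢ d → val y u ≡ X u
    y-other u≢c u≢d = cong X (T-other c d u≢c u≢d)

    cd-good : toℕ c < p₁ → X c < p₂ → ¬ (toℕ d < p₁ × X d < p₂) → GoodPair x
    cd-good c<p₁ xc<p₂ d∉ = c , d , c<d , xc<xd , ((c<p₁ , xc<p₂) , d∉) , y≤w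

    lift : ∀ {a b a′ b′ k l} → (y ·t[ a , b ]) ≤B w → ∀ i j → toℕ i < toℕ j →
           T a′ b′ i ≡ k → T a′ b′ j ≡ l → X k < X l →
           (∀ u → T a′ b′ (T i j u) ≡ T c d (T a b u)) → (x ·t[ a′ , b′ ]) ≤B w
    lift yt≤w i j i<j refl refl xk<xl slide = climb (x ·t[ _ , _ ]) i<j xk<xl (λ u → cong (x ⟨$⟩ʳ_) (slide u)) yt≤w

    outside : ∀ {u} → u ≢ c → u ≢ d → ¬ (toℕ u < p₁ × val y u < p₂) → ¬ (toℕ u < p₁ × X u < p₂)
    outside u≢c u≢d u∉ (u<p₁ , xu<p₂) = u∉ (u<p₁ , subst (_< p₂) (sym (y-other u≢c u≢d)) xu<p₂)

    from-c : ∀ {b} → b ≢ c → b ≢ d → Good y c b → GoodPair x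
    from-c {b} b≢c b≢d (c<b , yc<yb , ((c<p₁ , yc<p₂) , b∉) , yt≤w) = choose (toℕ b <? toℕ d) (toℕ d <? p₁)
      where
        xd<xb : X d < X b
        xd<xb = subst₂ _<_ yc (y-other b≢c b≢d) yc<yb
        xd<p₂ : X d < p₂
        xd<p₂ = subst (_< p₂) yc yc<p₂
        choose : Dec (toℕ b < toℕ d) → Dec (toℕ d < p₁) → GoodPair x
        choose (yes b<d) _ =
          c , b , c<b , <-trans xc<xd xd<xb , ((c<p₁ , <-trans xc<xd xd<p₂) , outside b≢c b≢d b∉) ,
          lift yt≤w b d b<d (T-right c b) (T-other c b (c≢d ∘ sym) (b≢d ∘ sym)) xc<xd
               (T-slide c b (T-right c b) (T-other c b (c≢d ∘ sym) (b≢d ∘ sym)))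
        choose (no b≮d) (yes d<p₁) =
          d , b , ≮∧≢⇒> b≮d (b≢d ∘ toℕ-injective ∘ sym) , xd<xb , ((d<p₁ , xd<p₂) , outside b≢c b≢d b∉) ,
          lift yt≤w c d c<d (T-other d b c≢d (b≢c ∘ sym)) (T-left d b) (<-trans xc<xd xd<xb)
               (λ u → sym (T-slide c d (T-left c d) (T-other c d b≢c b≢d) u))
        choose (no _) (no d≮p₁) = cd-good c<p₁ (<-trans xc<xd xd<p₂) (d≮p₁ ∘ proj₁)

    from-d : ∀ {b} → b ≢ c → b ≢ d → Good y d b → GoodPair x
    from-d {b} b≢c b≢d (d<b , yd<yb , ((d<p₁ , yd<p₂) , b∉) , yt≤w) = choose (X b <? X d) (X d <? p₂)
      where
        xc<xb : X c < X b
        xc<xb = subst₂ _<_ yd (y-other b≢c b≢d) yd<yb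
        xc<p₂ : X c < p₂
        xc<p₂ = subst (_< p₂) yd yd<p₂
        choose : Dec (X b < X d) → Dec (X d < p₂) → GoodPair x
        choose (yes xb<xd) _ =
          c , b , <-trans c<d d<b , xc<xb , ((<-trans c<d d<p₁ , xc<p₂) , outside b≢c b≢d b∉) ,
          lift yt≤w c d c<d (T-left c b) (T-other c b (c≢d ∘ sym) (b≢d ∘ sym)) xb<xd
               (λ u → sym (T-slide c d (T-right c d) (T-other c d b≢c b≢d) u))
        choose (no xb≮xd) (yes xd<p₂) =
          d , b , d<b , ≮∧≢⇒> xb≮xd (b≢d ∘ sym ∘ val-injective x) , ((d<p₁ , xd<p₂) , outside b≢c b≢d b∉) ,
          lift yt≤w c b (<-trans c<d d<b) (T-other d b c≢d (b≢c ∘ sym)) (T-right d b) xc<xd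
               (T-slide d b (T-other d b c≢d (b≢c ∘ sym)) (T-right d b))
        choose (no _) (no xd≮p₂) = cd-good (<-trans c<d d<p₁) xc<p₂ (xd≮p₂ ∘ proj₂)

    to-c : ∀ {a} → a ≢ c → a ≢ d → Good y a c → GoodPair x
    to-c {a} a≢c a≢d (a<c , ya<yc , ((a<p₁ , ya<p₂) , c∉) , yt≤w) = choose (X c <? X a) (box? x c)
      where
        xa<xd : X a < X d
        xa<xd = subst₂ _<_ (y-other a≢c a≢d) yc ya<yc
        xa<p₂ : X a < p₂
        xa<p₂ = subst (_< p₂) (y-other a≢c a≢d) ya<p₂
        c∉′ : ¬ (toℕ c < p₁ × X d < p₂)
        c∉′ (c<p₁ , xd<p₂) = c∉ (c<p₁ , subst (_< p₂) (sym yc) xd<p₂)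
        choose : Dec (X c < X a) → Dec (toℕ c < p₁ × X c < p₂) → GoodPair x
        choose (yes xc<xa) _ =
          a , d , <-trans a<c c<d , xa<xd ,
          ((a<p₁ , xa<p₂) , λ { (d<p₁ , xd<p₂) → c∉′ (<-trans c<d d<p₁ , xd<p₂) }) ,
          lift yt≤w c d c<d (T-other a d (a≢c ∘ sym) c≢d) (T-right a d) xc<xa
               (λ u → sym (T-slide c d (T-other c d a≢c a≢d) (T-left c d) u))
        choose (no _) (yes (c<p₁ , xc<p₂)) = cd-good c<p₁ xc<p₂ (λ { (_ , xd<p₂) → c∉′ (c<p₁ , xd<p₂) })
        choose (no xc≮xa) (no c∉x) =
          a , c , a<c , ≮∧≢⇒> xc≮xa (a≢c ∘ val-injective x) , ((a<p₁ , xa<p₂) , c∉x) ,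
          lift yt≤w a d (<-trans a<c c<d) (T-left a c) (T-other a c (a≢d ∘ sym) (c≢d ∘ sym)) xc<xd
               (T-slide a c (T-left a c) (T-other a c (a≢d ∘ sym) (c≢d ∘ sym)))

    to-d : ∀ {a} → a ≢ c → a ≢ d → Good y a d → GoodPair x
    to-d {a} a≢c a≢d (a<d , ya<yd , ((a<p₁ , ya<p₂) , d∉) , yt≤w) = choose (toℕ a <? toℕ c) (box? x c)
      where
        xa<xc : X a < X c
        xa<xc = subst₂ _<_ (y-other a≢c a≢d) yd ya<yd
        xa<p₂ : X a < p₂
        xa<p₂ = subst (_< p₂) (y-other a≢c a≢d) ya<p₂
        d∉′ : ¬ (toℕ d < p₁ × X c < p₂)
        d∉′ (d<p₁ , xc<p₂) = d∉ (d<p₁ , subst (_< p₂) (sym yd) xc<p₂)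
        choose : Dec (toℕ a < toℕ c) → Dec (toℕ c < p₁ × X c < p₂) → GoodPair x
        choose (yes _) (yes (c<p₁ , xc<p₂)) = cd-good c<p₁ xc<p₂ (λ { (d<p₁ , _) → d∉′ (d<p₁ , xc<p₂) })
        choose (yes a<c) (no c∉x) =
          a , c , a<c , xa<xc , ((a<p₁ , xa<p₂) , c∉x) ,
          lift yt≤w c d c<d (T-right a c) (T-other a c (a≢d ∘ sym) (c≢d ∘ sym)) (<-trans xa<xc xc<xd)
               (λ u → sym (T-slide c d (T-other c d a≢c a≢d) (T-right c d) u))
        choose (no a≮c) _ =
          a , d , a<d , <-trans xa<xc xc<xd ,
          ((a<p₁ , xa<p₂) , λ { (d<p₁ , xd<p₂) → d∉′ (d<p₁ , <-trans xc<xd xd<p₂) }) ,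
          lift yt≤w c a (≮∧≢⇒> a≮c (a≢c ∘ sym ∘ toℕ-injective)) (T-other a d (a≢c ∘ sym) c≢d) (T-left a d) xc<xd
               (T-slide a d (T-other a d (a≢c ∘ sym) c≢d) (T-left a d))

    disjoint : ∀ {a b} → a ≢ c → a ≢ d → b ≢ c → b ≢ d → Good y a b → GoodPair x
    disjoint {a} {b} a≢c a≢d b≢c b≢d (a<b , ya<yb , ((a<p₁ , ya<p₂) , b∉) , yt≤w) =
      a , b , a<b , subst₂ _<_ (y-other a≢c a≢d) (y-other b≢c b≢d) ya<yb ,
      ((a<p₁ , subst (_< p₂) (y-other a≢c a≢d) ya<p₂) , outside b≢c b≢d b∉) ,
      lift yt≤w c d c<d c-fixed d-fixed xc<xd (T-slide a b c-fixed d-fixed)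
      where
        c-fixed : T a b c ≡ c
        c-fixed = T-other a b (a≢c ∘ sym) (b≢c ∘ sym)
        d-fixed : T a b d ≡ d
        d-fixed = T-other a b (a≢d ∘ sym) (b≢d ∘ sym)

    transfer : GoodPair y → GoodPair x
    transfer (a , b , g) with position c d a | position c d b
    ... | at-i              | at-i              = ⊥-elim (<-irrefl refl (proj₁ g))
    ... | at-i              | at-j              = ⊥-elim (<-asym xc<xd (subst₂ _<_ yc yd (proj₁ (proj₂ g))))
    ... | at-i              | elsewhere b≢c b≢d = from-c b≢c b≢d g
    ... | at-j              | at-i              = ⊥-elim (<-asym c<d (proj₁ g))
    ... | at-j              | at-j              = ⊥-elim (<-irrefl refl (proj₁ g))
    ... | at-j              | elsewhere b≢c b≢d = from-d b≢c b≢d g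
    ... | elsewhere a≢c a≢d | at-i              = to-c a≢c a≢d g
    ... | elsewhere a≢c a≢d | at-j              = to-d a≢c a≢d g
    ... | elsewhere a≢c a≢d | elsewhere b≢c b≢d = disjoint a≢c a≢d b≢c b≢d g

  crosses? : ∀ x c d → Dec (Crosses x (p₁ , p₂) c d)
  crosses? x c d = box? x c ×-dec ¬? (box? x d)

  -- Follow an ascent
  -- chain from x to w: its first exchange is good if it crosses p; otherwise it
  -- keeps the rank at p, and a good pair of the next permutation transfers to x.
  good-pair : ∀ {x} → x ↝ w → rk x p₁ p₂ ≢ rk w p₁ p₂ → GoodPair x
  good-pair {x} (stop x≈w) rk≢ = contradiction (rk-cong {x = x} {y = w} p₁ p₂ x≈w) rk≢
  good-pair {x} (step c d c<d xc<xd rest) rk≢ with crosses? x c d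
  ... | yes cross = c , d , c<d , xc<xd , cross , ↝⇒≤B rest
  ... | no ¬cross = Transfer.transfer x c<d xc<xd (↝⇒≤B rest)
                      (good-pair rest (rk≢ ∘ trans (sym (rk-swap x p₁ p₂ c<d xc<xd ¬cross))))

  Inside : Perm n → Fin n → Fin n → Fin n → Set
  Inside x a b c = toℕ a < toℕ c × toℕ c < toℕ b × val x a < val x c × val x c < val x b

  inside? : ∀ x a b → Decidable (Inside x a b)
  inside? x a b c = (toℕ a <? toℕ c) ×-dec (toℕ c <? toℕ b) ×-dec (val x a <? val x c) ×-dec (val x c <? val x b)

  -- A good pair (a, b) with a point c inside its rectangle can be shrunk to
  -- (c, b) if (c, x(c)) ≤ p and to (a, c) otherwise.  In both cases the chain
  -- x t_{ab} = x t_{cb} t_{ac} t_{cb} of two ascent exchanges shows the new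
  -- exchange is still below w.
  shrink-right : ∀ {x a b c} → Good x a b → Inside x a b c → (c , x ⟨$⟩ʳ c) ≤pt (p₁ , p₂) → Good x c b
  shrink-right {x} {a} {b} {c} (a<b , xa<xb , (_ , b∉) , xt≤w) (a<c , c<b , xa<xc , xc<xb) c∈ =
    c<b , xc<xb , (c∈ , b∉) ,
    climb (x ·t[ c , b ]) a<c (subst₂ _<_ (cong (val x) (sym a-fixed)) (cong (val x) (sym (T-left c b))) xa<xb)
          (λ _ → refl)
          (climb ((x ·t[ c , b ]) ·t[ a , c ]) c<b
                 (subst₂ _<_ (cong (val x) (sym (trans (cong (T c b) (T-right a c)) a-fixed)))
                             (cong (val x) (sym (trans (cong (T c b) (T-other a c b≢a b≢c)) (T-right c b))))
                             xa<xc)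
                 (λ u → cong (x ⟨$⟩ʳ_) (T-conjugate a≢c a≢b u)) xt≤w)
    where
      a≢c = <⇒≢F a<c
      a≢b = <⇒≢F a<b
      b≢a = a≢b ∘ sym
      b≢c = <⇒≢F c<b ∘ sym
      a-fixed : T c b a ≡ a
      a-fixed = T-other c b a≢c a≢b

  shrink-left : ∀ {x a b c} → Good x a b → Inside x a b c → ¬ (c , x ⟨$⟩ʳ c) ≤pt (p₁ , p₂) → Good x a c
  shrink-left {x} {a} {b} {c} (a<b , xa<xb , (a∈ , _) , xt≤w) (a<c , c<b , xa<xc , xc<xb) c∉ =
    a<c , xa<xc , (a∈ , c∉) ,
    climb (x ·t[ a , c ]) a<b (subst₂ _<_ (cong (val x) (sym (T-left a c))) (cong (val x) (sym b-fixed)) xc<xb)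
          (λ _ → refl)
          (climb ((x ·t[ a , c ]) ·t[ a , b ]) c<b
                 (subst₂ _<_ (cong (val x) (sym (trans (cong (T a c) (T-other a b (a≢c ∘ sym) c≢b)) (T-right a c))))
                             (cong (val x) (sym (trans (cong (T a c) (T-right a b)) (T-left a c))))
                             xa<xc)
                 (λ u → cong (x ⟨$⟩ʳ_) (trans (T-slide a c (T-left a c) b-fixed (T c b u)) (T-conjugate a≢c a≢b u)))
                 xt≤w)
    where
      a≢c = <⇒≢F a<c
      a≢b = <⇒≢F a<b
      c≢b = <⇒≢F c<b
      b-fixed : T a c b ≡ b
      b-fixed = T-other a c (a≢b ∘ sym) (c≢b ∘ sym)

  -- Shrinking until the rectangle is empty (k bounds the width b - a).
  refine : ∀ k {x a b} → toℕ b ≤ toℕ a + k → Good x a b →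
           ∃[ a′ ] ∃[ b′ ] (Good x a′ b′ × EmptyRectangle x a′ b′)
  refine zero {a = a} b≤a+0 (a<b , _) = contradiction (<-≤-trans a<b (≤-trans b≤a+0 (≤-reflexive (+-identityʳ (toℕ a))))) (<-irrefl refl)
  refine (suc k) {x} {a} {b} b≤a+k+1 g with any? (inside? x a b)
  ... | no nothing-inside = a , b , g , λ c a<c c<b xa<xc xc<xb → nothing-inside (c , a<c , c<b , xa<xc , xc<xb)
  ... | yes (c , inside@(a<c , c<b , _)) with box? x c
  ...   | yes c∈ = refine k {x} {c} {b} (≤-trans b≤a+k+1 (≤-trans (≤-reflexive (+-suc (toℕ a) k)) (+-monoˡ-≤ k a<c)))
                            (shrink-right {x} {a} {b} {c} g inside c∈)
  ...   | no c∉  = refine k {x} {a} {c} (s≤s⁻¹ (≤-trans c<b (≤-trans b≤a+k+1 (≤-reflexive (+-suc (toℕ a) k)))))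
                            (shrink-left {x} {a} {b} {c} g inside c∉)

  empty-good-pair : ∀ {x} → x ≤B w → rk x p₁ p₂ ≢ rk w p₁ p₂ →
                    ∃[ a ] ∃[ b ] (Good x a b × EmptyRectangle x a b)
  empty-good-pair {x} x≤w rk≢ with good-pair (≤B⇒↝ x≤w) rk≢
  ... | a , b , g = refine (toℕ b) {x} {a} {b} (m≤n+m (toℕ b) (toℕ a)) g

-- The theorem: for p ∈ X^c_τ a good pair with empty rectangle exists; its
-- transposition lies in A_τ(p), and by the covering criterion also in R'_τ.
lemma4p15 : (n : ℕ) (w x : Perm n) → x ≤B w → (p : ℕ × ℕ) → InXc w x p →
    ∃[ i₁ ] ∃[ i₂ ] (InA w x p i₁ i₂ × InR' w x i₁ i₂)
lemma4p15 n w x x≤w (p₁ , p₂) (_ , rk≢)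
  with GoodPairs.empty-good-pair w p₁ p₂ x≤w rk≢
... | a , b , (a<b , xa<xb , cross , xt≤w) , empty =
  a , b , ((a<b , x<xt , xt≤w) , cross) , (a<b , (x<xt , LengthChange.length-covers x a<b xa<xb empty) , xt≤w)
  where
    x<xt : x <B (x ·t[ a , b ])
    x<xt = ascent-<B x a<b xa<xb
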